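{- Let $k$ be a positive integer and $[2k+3]=\{1,2,\ldots,2k+3\}$. For any $(k+1)$-element subset $I\subset[2k+3]$, the number of $(k+1)$-element subsets $J\subset[2k+3]\setminus I$ that alternate with $I$ is even.
   Context: Two $p$-element subsets $\{s_1,\ldots,s_p\},\{t_1,\ldots,t_p\}\subset\mathbb{R}$ alternate if their elements can be ordered so that either $s_1<t_1<s_2<t_2<\cdots<s_p<t_p$ or $t_1<s_1<t_2<s_2<\cdots<t_p<s_p$. -}

module Defs where

open import Data.Bool using (Bool; true; false; if_then_else_)
open import Data.Nat using (ℕ; zero; suc; _<_; _<?_; _≟_)
open import Data.List using (List; []; _∷_; map; length; filter; _++_)
open import Data.Vec using (_∷_; [])
open import Data.Product using (_×_)
open import Data.Sum using (_⊎_)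
open import Relation.Binary.PropositionalEquality using (_≡_)
open import Relation.Nullary using (Dec)
open import Relation.Nullary.Decidable using (_×-dec_; _⊎-dec_)
open import Data.List.Relation.Unary.Linked using (Linked; linked?)
open import Data.Fin.Subset using (Subset; _⊆_; ∁; ∣_∣)
open import Data.Fin.Subset.Properties using (_⊆?_)

-- A subset of [n] = {1,…,n} is a Subset n (Vec Bool n); position i (0-based)
-- stands for the element i+1.  Shifting all elements by 1 does not affect
-- the order relations, so we list elements by their 0-based index.

elems : ∀ {n} → Subset n → List ℕ
elems [] = []
elems (b ∷ p) = if b then 0 ∷ map suc (elems p) else map suc (elems p)

allSubsets : (n : ℕ) → List (Subset n)
allSubsets zero = [] ∷ []
allSubsets (suc n) = map (true ∷_) (allSubsets n) ++ map (false ∷_) (allSubsets n)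

interleave : List ℕ → List ℕ → List ℕ
interleave (s ∷ ss) (t ∷ ts) = s ∷ t ∷ interleave ss ts
interleave _ _ = []

AlternateL : List ℕ → List ℕ → Set
AlternateL S T = length S ≡ length T
               × (Linked _<_ (interleave S T) ⊎ Linked _<_ (interleave T S))

Alternate : ∀ {n} → Subset n → Subset n → Set
Alternate I J = AlternateL (elems I) (elems J)

alternate? : ∀ {n} (I J : Subset n) → Dec (Alternate I J)
alternate? I J = (length (elems I) ≟ length (elems J))
  ×-dec (linked? _<?_ (interleave (elems I) (elems J))
         ⊎-dec linked? _<?_ (interleave (elems J) (elems I)))

Good : ∀ {n} → ℕ → Subset n → Subset n → Set
Good p I J = (J ⊆ ∁ I) × (∣ J ∣ ≡ p) × Alternate I J

good? : ∀ {n} (p : ℕ) (I J : Subset n) → Dec (Good p I J)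
good? p I J = (J ⊆? ∁ I) ×-dec (∣ J ∣ ≟ p) ×-dec alternate? I J

countAlternating : ∀ {n} → ℕ → Subset n → ℕ
countAlternating {n} p I = length (filter (good? p I) (allSubsets n))

{-# OPTIONS --safe #-}
module Submission where

-- Scanning the positions from left to right, J alternates with I exactly when a two-state
-- automaton recording whose turn it is accepts the pair.  An alternating J is disjoint from I,
-- so under |∁ I| = |I| + 1 = |J| + 1 it is ∁ I with a single point omitted.  Counting these by
-- recursion along I and reducing modulo 2, the admissible omitted points in the interior come
-- in adjacent pairs, and only the two ends survive: the numbers of I-first and of J-first
-- alternating J are both congruent to 1 or 0 according as ∁ I itself alternates with I,
-- starting and ending in ∁ I, so their sum is even.

open import Defs
open import Data.Bool using (false; true)
open import Data.Empty using (⊥; ⊥-elim)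
open import Data.Fin.Subset using (Subset; _⊆_; ∁; ∣_∣; inside; outside)
open import Data.Fin.Subset.Properties using (p⊆q⇒∣p∣≤∣q∣; ∣∁p∣≡n∸∣p∣)
open import Data.List using (List; []; _∷_; map; length; filter; _++_)
open import Data.List.Properties using (filter-++; length-++; filter-≐)
open import Data.List.Relation.Unary.All as All using (All; []; _∷_)
open import Data.List.Relation.Unary.Linked as Linked using (Linked; []; [-]; _∷_)
open import Data.Nat using (ℕ; zero; suc; _+_; _*_; _∸_; _<_; _≤_; _≟_; NonZero; parity)
open import Data.Nat.Divisibility using (_∣_; divides)
open import Data.Nat.Properties
open import Data.Nat.Tactic.RingSolver using (solve-∀)
open import Data.Parity.Base using (0ℙ) renaming (_+_ to _⊕_)
import Data.Parity.Properties as ℙ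
open import Data.Product using (_×_; _,_)
open import Data.Sum as Sum using (_⊎_; inj₁; inj₂)
open import Data.Vec using ([]; _∷_; here; there)
open import Function using (_∘_)
open import Level using (Level; 0ℓ)
open import Relation.Binary.PropositionalEquality
  using (_≡_; refl; sym; trans; cong; cong₂; subst₂; module ≡-Reasoning)
open import Relation.Nullary using (Dec; yes; no; does)
open import Relation.Nullary.Decidable using (map′; _×-dec_)
open import Relation.Unary using (Pred; Decidable; _≐_; _∪_; ∅)
open import Relation.Unary.Properties using (_∪?_; ∅?)

private
  variable
    α ℓ ℓ′ : Level
    A B : Set α
    n : ℕ

data Turn : Set where
  I-turn J-turn : Turn

other : Turn → Turn
other I-turn = J-turn
other J-turn = I-turn

-- Reading I and J from left to right, their elements alternate; it is s's turn at the start
-- and t's turn at the end.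
data Alternation : Turn → Turn → Subset n → Subset n → Set where
  []    : ∀ {t} → Alternation t t [] []
  skip  : ∀ {s t} {I J : Subset n} →
          Alternation s t I J → Alternation s t (outside ∷ I) (outside ∷ J)
  takeI : ∀ {t} {I J : Subset n} →
          Alternation J-turn t I J → Alternation I-turn t (inside ∷ I) (outside ∷ J)
  takeJ : ∀ {t} {I J : Subset n} →
          Alternation I-turn t I J → Alternation J-turn t (outside ∷ I) (inside ∷ J)

alternation? : ∀ s t (I J : Subset n) → Dec (Alternation s t I J)
alternation? I-turn I-turn [] [] = yes []
alternation? J-turn J-turn [] [] = yes []
alternation? I-turn J-turn [] [] = no λ ()
alternation? J-turn I-turn [] [] = no λ ()
alternation? s t (outside ∷ I) (outside ∷ J) =
  map′ skip (λ { (skip a) → a }) (alternation? s t I J)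
alternation? I-turn t (inside ∷ I) (outside ∷ J) =
  map′ takeI (λ { (takeI a) → a }) (alternation? J-turn t I J)
alternation? J-turn t (outside ∷ I) (inside ∷ J) =
  map′ takeJ (λ { (takeJ a) → a }) (alternation? I-turn t I J)
alternation? J-turn t (inside ∷ I) (outside ∷ J) = no λ ()
alternation? I-turn t (outside ∷ I) (inside ∷ J) = no λ ()
alternation? s t (inside ∷ I) (inside ∷ J) = no λ ()

alternation-swap : ∀ {s t} {I J : Subset n} →
  Alternation s t I J → Alternation (other s) (other t) J I
alternation-swap [] = []
alternation-swap (skip a) = skip (alternation-swap a)
alternation-swap (takeI a) = takeJ (alternation-swap a)
alternation-swap (takeJ a) = takeI (alternation-swap a)

alternation⇒⊆∁ : ∀ {s t} {I J : Subset n} → Alternation s t I J → J ⊆ ∁ I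
alternation⇒⊆∁ (skip a) (there x∈J) = there (alternation⇒⊆∁ a x∈J)
alternation⇒⊆∁ (takeI a) (there x∈J) = there (alternation⇒⊆∁ a x∈J)
alternation⇒⊆∁ (takeJ a) here = here
alternation⇒⊆∁ (takeJ a) (there x∈J) = there (alternation⇒⊆∁ a x∈J)

alternations-from-both-turns⇒∣I∣≡0 : ∀ {t t′} {I J : Subset n} →
  Alternation I-turn t I J → Alternation J-turn t′ I J → ∣ I ∣ ≡ 0
alternations-from-both-turns⇒∣I∣≡0 [] [] = refl
alternations-from-both-turns⇒∣I∣≡0 (skip a) (skip b) =
  alternations-from-both-turns⇒∣I∣≡0 a b

elemsFrom : ℕ → Subset n → List ℕ
elemsFrom m [] = []
elemsFrom m (inside ∷ p) = m ∷ elemsFrom (suc m) p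
elemsFrom m (outside ∷ p) = elemsFrom (suc m) p

map-suc-elemsFrom : ∀ m (p : Subset n) → map suc (elemsFrom m p) ≡ elemsFrom (suc m) p
map-suc-elemsFrom m [] = refl
map-suc-elemsFrom m (inside ∷ p) = cong (suc m ∷_) (map-suc-elemsFrom (suc m) p)
map-suc-elemsFrom m (outside ∷ p) = map-suc-elemsFrom (suc m) p

elems≡elemsFrom0 : ∀ (p : Subset n) → elems p ≡ elemsFrom 0 p
elems≡elemsFrom0 [] = refl
elems≡elemsFrom0 (inside ∷ p) =
  cong (0 ∷_) (trans (cong (map suc) (elems≡elemsFrom0 p)) (map-suc-elemsFrom 0 p))
elems≡elemsFrom0 (outside ∷ p) =
  trans (cong (map suc) (elems≡elemsFrom0 p)) (map-suc-elemsFrom 0 p)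

elemsFrom-≥ : ∀ m (p : Subset n) → All (m ≤_) (elemsFrom m p)
elemsFrom-≥ m [] = []
elemsFrom-≥ m (inside ∷ p) = ≤-refl ∷ All.map <⇒≤ (elemsFrom-≥ (suc m) p)
elemsFrom-≥ m (outside ∷ p) = All.map <⇒≤ (elemsFrom-≥ (suc m) p)

All-interleave : ∀ {P : Pred ℕ ℓ} {S T} → All P S → All P T → All P (interleave S T)
All-interleave [] _ = []
All-interleave (_ ∷ _) [] = []
All-interleave (ps ∷ pS) (pt ∷ pT) = ps ∷ pt ∷ All-interleave pS pT

linked-∷ : ∀ {x xs} → All (x <_) xs → Linked _<_ xs → Linked _<_ (x ∷ xs)
linked-∷ [] _ = [-]
linked-∷ (x<y ∷ _) l = x<y ∷ l

Interleaved : List ℕ → List ℕ → Set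
Interleaved S T = length S ≡ length T × Linked _<_ (interleave S T)

interleaved⇒alternation : ∀ m (I J : Subset n) →
  Interleaved (elemsFrom m I) (elemsFrom m J) → Alternation I-turn I-turn I J
-- In the J-turn state the last element x of I has been read and awaits its partner in J.
interleaved⇒alternation-pending : ∀ {x} m → x < m → (I J : Subset n) →
  Interleaved (x ∷ elemsFrom m I) (elemsFrom m J) → Alternation J-turn I-turn I J

interleaved⇒alternation m [] [] _ = []
interleaved⇒alternation m (outside ∷ I) (outside ∷ J) h =
  skip (interleaved⇒alternation (suc m) I J h)
interleaved⇒alternation m (inside ∷ I) (outside ∷ J) h =
  takeI (interleaved⇒alternation-pending (suc m) ≤-refl I J h)
interleaved⇒alternation m (outside ∷ I) (inside ∷ J) h
  with elemsFrom (suc m) I | elemsFrom-≥ (suc m) I | h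
... | i ∷ _ | m<i ∷ _ | _ , i<m ∷ _ = ⊥-elim (<-asym m<i i<m)
interleaved⇒alternation m (inside ∷ I) (inside ∷ J) (_ , m<m ∷ _) =
  ⊥-elim (<-irrefl refl m<m)

interleaved⇒alternation-pending m x<m (outside ∷ I) (outside ∷ J) h =
  skip (interleaved⇒alternation-pending (suc m) (m<n⇒m<1+n x<m) I J h)
interleaved⇒alternation-pending m x<m (outside ∷ I) (inside ∷ J) (eq , l) =
  takeJ (interleaved⇒alternation (suc m) I J (suc-injective eq , Linked.tail (Linked.tail l)))
interleaved⇒alternation-pending m x<m (inside ∷ I) (outside ∷ J) h
  with elemsFrom (suc m) J | elemsFrom-≥ (suc m) J | h
... | _ ∷ _ ∷ _ | m<j ∷ _ | _ , _ ∷ j<m ∷ _ = ⊥-elim (<-asym m<j j<m)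
interleaved⇒alternation-pending m x<m (inside ∷ I) (inside ∷ J) h
  with elemsFrom (suc m) J | h
... | _ ∷ _ | _ , _ ∷ m<m ∷ _ = ⊥-elim (<-irrefl refl m<m)

alternation⇒interleaved : ∀ m {I J : Subset n} →
  Alternation I-turn I-turn I J → Interleaved (elemsFrom m I) (elemsFrom m J)
alternation⇒interleaved-pending : ∀ {x} m → x < m → {I J : Subset n} →
  Alternation J-turn I-turn I J → Interleaved (x ∷ elemsFrom m I) (elemsFrom m J)

alternation⇒interleaved m [] = refl , []
alternation⇒interleaved m (skip a) = alternation⇒interleaved (suc m) a
alternation⇒interleaved m (takeI a) = alternation⇒interleaved-pending (suc m) ≤-refl a

alternation⇒interleaved-pending m x<m (skip a) =
  alternation⇒interleaved-pending (suc m) (m<n⇒m<1+n x<m) a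
alternation⇒interleaved-pending m x<m (takeJ {I = I} {J = J} a)
  with eq , l ← alternation⇒interleaved (suc m) a =
  cong suc eq , x<m ∷ linked-∷ (All-interleave (elemsFrom-≥ (suc m) I) (elemsFrom-≥ (suc m) J)) l

elems-interleaved⇒alternation : {I J : Subset n} →
  Interleaved (elems I) (elems J) → Alternation I-turn I-turn I J
elems-interleaved⇒alternation {I = I} {J} =
  interleaved⇒alternation 0 I J ∘ subst₂ Interleaved (elems≡elemsFrom0 I) (elems≡elemsFrom0 J)

alternation⇒elems-interleaved : {I J : Subset n} →
  Alternation I-turn I-turn I J → Interleaved (elems I) (elems J)
alternation⇒elems-interleaved {I = I} {J} =
  subst₂ Interleaved (sym (elems≡elemsFrom0 I)) (sym (elems≡elemsFrom0 J))
  ∘ alternation⇒interleaved 0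

alternate⇒alternation : {I J : Subset n} →
  Alternate I J → Alternation I-turn I-turn I J ⊎ Alternation J-turn J-turn I J
alternate⇒alternation (eq , inj₁ l) = inj₁ (elems-interleaved⇒alternation (eq , l))
alternate⇒alternation (eq , inj₂ l) =
  inj₂ (alternation-swap (elems-interleaved⇒alternation (sym eq , l)))

alternation⇒alternate : {I J : Subset n} →
  Alternation I-turn I-turn I J ⊎ Alternation J-turn J-turn I J → Alternate I J
alternation⇒alternate (inj₁ a) with eq , l ← alternation⇒elems-interleaved a = eq , inj₁ l
alternation⇒alternate (inj₂ a)
  with eq , l ← alternation⇒elems-interleaved (alternation-swap a) = sym eq , inj₂ l

count : {P : Pred A ℓ} → Decidable P → List A → ℕ
count P? = length ∘ filter P?

count-map : (f : A → B) {P : Pred B ℓ} (P? : Decidable P) →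
  ∀ xs → count P? (map f xs) ≡ count (P? ∘ f) xs
count-map f P? [] = refl
count-map f P? (x ∷ xs) with does (P? (f x))
... | true = cong suc (count-map f P? xs)
... | false = count-map f P? xs

count-≐ : {P : Pred A ℓ} {Q : Pred A ℓ′} (P? : Decidable P) (Q? : Decidable Q) →
  P ≐ Q → ∀ xs → count P? xs ≡ count Q? xs
count-≐ P? Q? P≐Q xs = cong length (filter-≐ P? Q? P≐Q xs)

count-∅ : ∀ (xs : List A) → count ∅? xs ≡ 0
count-∅ [] = refl
count-∅ (x ∷ xs) = count-∅ xs

count-∪ : {P : Pred A ℓ} {Q : Pred A ℓ′} (P? : Decidable P) (Q? : Decidable Q) →
  (∀ {x} → P x → Q x → ⊥) → ∀ xs → count (P? ∪? Q?) xs ≡ count P? xs + count Q? xs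
count-∪ P? Q? disjoint [] = refl
count-∪ P? Q? disjoint (x ∷ xs) with P? x | Q? x
... | yes p | yes q = ⊥-elim (disjoint p q)
... | yes _ | no _ = cong suc (count-∪ P? Q? disjoint xs)
... | no _ | yes _ = trans (cong suc (count-∪ P? Q? disjoint xs)) (sym (+-suc _ _))
... | no _ | no _ = count-∪ P? Q? disjoint xs

count-allSubsets-suc : {P : Pred (Subset (suc n)) ℓ} {Q R : Pred (Subset n) ℓ′}
  (P? : Decidable P) (Q? : Decidable Q) (R? : Decidable R) →
  (P ∘ (inside ∷_)) ≐ Q → (P ∘ (outside ∷_)) ≐ R →
  count P? (allSubsets (suc n)) ≡ count Q? (allSubsets n) + count R? (allSubsets n)
count-allSubsets-suc {n = n} P? Q? R? P≐Q P≐R = begin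
  count P? (map (inside ∷_) S ++ map (outside ∷_) S)
    ≡⟨ cong length (filter-++ P? (map (inside ∷_) S) _) ⟩
  length (filter P? (map (inside ∷_) S) ++ filter P? (map (outside ∷_) S))
    ≡⟨ length-++ (filter P? (map (inside ∷_) S)) ⟩
  count P? (map (inside ∷_) S) + count P? (map (outside ∷_) S)
    ≡⟨ cong₂ _+_ (count-map (inside ∷_) P? S) (count-map (outside ∷_) P? S) ⟩
  count (P? ∘ (inside ∷_)) S + count (P? ∘ (outside ∷_)) S
    ≡⟨ cong₂ _+_ (count-≐ _ Q? P≐Q S) (count-≐ _ R? P≐R S) ⟩
  count Q? S + count R? S ∎
  where
  open ≡-Reasoning
  S = allSubsets n

Omitting : ℕ → Turn → Turn → Subset n → Pred (Subset n) 0ℓ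
Omitting k s t I J = k + ∣ J ∣ ≡ ∣ ∁ I ∣ × Alternation s t I J

omitting? : ∀ k s t (I : Subset n) → Decidable (Omitting k s t I)
omitting? k s t I J = (k + ∣ J ∣ ≟ ∣ ∁ I ∣) ×-dec alternation? s t I J

#Omitting : ℕ → Turn → Turn → Subset n → ℕ
#Omitting k I-turn t (inside ∷ I) = #Omitting k J-turn t I
#Omitting k J-turn t (inside ∷ I) = 0
#Omitting zero I-turn t (outside ∷ I) = 0
#Omitting (suc k) I-turn t (outside ∷ I) = #Omitting k I-turn t I
#Omitting zero J-turn t (outside ∷ I) = #Omitting zero I-turn t I
#Omitting (suc k) J-turn t (outside ∷ I) = #Omitting (suc k) I-turn t I + #Omitting k J-turn t I
#Omitting zero I-turn I-turn [] = 1
#Omitting zero J-turn J-turn [] = 1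
#Omitting zero I-turn J-turn [] = 0
#Omitting zero J-turn I-turn [] = 0
#Omitting (suc k) s t [] = 0

Omitting-takeI≐ : ∀ {k t} {I : Subset n} →
  (Omitting k I-turn t (inside ∷ I) ∘ (outside ∷_)) ≐ Omitting k J-turn t I
Omitting-takeI≐ = (λ { (e , takeI a) → e , a }) , λ { (e , a) → e , takeI a }

Omitting-takeJ≐ : ∀ {k t} {I : Subset n} →
  (Omitting k J-turn t (outside ∷ I) ∘ (inside ∷_)) ≐ Omitting k I-turn t I
Omitting-takeJ≐ {k = k} =
    (λ { (e , takeJ a) → suc-injective (trans (sym (+-suc k _)) e) , a })
  , (λ { (e , a) → trans (+-suc k _) (cong suc e) , takeJ a })

Omitting-skip≐ : ∀ {k s t} {I : Subset n} →
  (Omitting (suc k) s t (outside ∷ I) ∘ (outside ∷_)) ≐ Omitting k s t I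
Omitting-skip≐ = (λ { (e , skip a) → suc-injective e , a }) , λ { (e , a) → cong suc e , skip a }

Omitting₀-skip≐∅ : ∀ {s t} {I : Subset n} → (Omitting 0 s t (outside ∷ I) ∘ (outside ∷_)) ≐ ∅
Omitting₀-skip≐∅ =
  (λ { (e , skip a) → ≤⇒≯ (p⊆q⇒∣p∣≤∣q∣ (alternation⇒⊆∁ a)) (≤-reflexive (sym e)) }) , λ ()

count-Omitting : ∀ k s t (I : Subset n) → count (omitting? k s t I) (allSubsets n) ≡ #Omitting k s t I
count-Omitting zero I-turn I-turn [] = refl
count-Omitting zero J-turn J-turn [] = refl
count-Omitting zero I-turn J-turn [] = refl
count-Omitting zero J-turn I-turn [] = refl
count-Omitting (suc k) I-turn t [] = refl
count-Omitting (suc k) J-turn t [] = refl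
count-Omitting {n = suc n} k I-turn t (inside ∷ I) =
  trans (count-allSubsets-suc (omitting? k I-turn t (inside ∷ I)) ∅? (omitting? k J-turn t I)
           ((λ { (_ , ()) }) , λ ()) Omitting-takeI≐)
        (cong₂ _+_ (count-∅ (allSubsets n)) (count-Omitting k J-turn t I))
count-Omitting {n = suc n} k J-turn t (inside ∷ I) =
  trans (count-allSubsets-suc (omitting? k J-turn t (inside ∷ I)) ∅? ∅?
           ((λ { (_ , ()) }) , λ ()) ((λ { (_ , ()) }) , λ ()))
        (cong₂ _+_ (count-∅ (allSubsets n)) (count-∅ (allSubsets n)))
count-Omitting {n = suc n} zero I-turn t (outside ∷ I) =
  trans (count-allSubsets-suc (omitting? zero I-turn t (outside ∷ I)) ∅? ∅?
           ((λ { (_ , ()) }) , λ ()) Omitting₀-skip≐∅)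
        (cong₂ _+_ (count-∅ (allSubsets n)) (count-∅ (allSubsets n)))
count-Omitting {n = suc n} (suc k) I-turn t (outside ∷ I) =
  trans (count-allSubsets-suc (omitting? (suc k) I-turn t (outside ∷ I)) ∅? (omitting? k I-turn t I)
           ((λ { (_ , ()) }) , λ ()) Omitting-skip≐)
        (cong₂ _+_ (count-∅ (allSubsets n)) (count-Omitting k I-turn t I))
count-Omitting {n = suc n} zero J-turn t (outside ∷ I) =
  trans (count-allSubsets-suc (omitting? zero J-turn t (outside ∷ I)) (omitting? zero I-turn t I) ∅?
           Omitting-takeJ≐ Omitting₀-skip≐∅)
        (trans (cong₂ _+_ (count-Omitting zero I-turn t I) (count-∅ (allSubsets n))) (+-identityʳ _))
count-Omitting {n = suc n} (suc k) J-turn t (outside ∷ I) =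
  trans (count-allSubsets-suc (omitting? (suc k) J-turn t (outside ∷ I))
           (omitting? (suc k) I-turn t I) (omitting? k J-turn t I)
           Omitting-takeJ≐ Omitting-skip≐)
        (cong₂ _+_ (count-Omitting (suc k) I-turn t I) (count-Omitting k J-turn t I))

parity-#Omitting₁-JI : ∀ (I : Subset n) → parity (#Omitting 1 J-turn I-turn I) ≡ 0ℙ
parity-#Omitting₁-II : ∀ (I : Subset n) →
  parity (#Omitting 1 I-turn I-turn I) ≡ parity (#Omitting 0 J-turn I-turn I)
parity-#Omitting₁-JJ : ∀ (I : Subset n) →
  parity (#Omitting 1 J-turn J-turn I) ≡ parity (#Omitting 0 J-turn I-turn I)
parity-#Omitting₁-IJ : ∀ (I : Subset n) →
  parity (#Omitting 1 I-turn J-turn I) ≡ parity (#Omitting 0 I-turn I-turn I + #Omitting 0 J-turn J-turn I)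

parity-#Omitting₁-JI [] = refl
parity-#Omitting₁-JI (inside ∷ I) = refl
parity-#Omitting₁-JI (outside ∷ I) = begin
  parity (#Omitting 1 I-turn I-turn I + b)  ≡⟨ ℙ.+-homo-+ (#Omitting 1 I-turn I-turn I) b ⟩
  parity (#Omitting 1 I-turn I-turn I) ⊕ parity b ≡⟨ cong (_⊕ parity b) (parity-#Omitting₁-II I) ⟩
  parity b ⊕ parity b                       ≡⟨ ℙ.p+p≡0ℙ (parity b) ⟩
  0ℙ                                        ∎
  where
  open ≡-Reasoning
  b = #Omitting 0 J-turn I-turn I

parity-#Omitting₁-II [] = refl
parity-#Omitting₁-II (inside ∷ I) = parity-#Omitting₁-JI I
parity-#Omitting₁-II (outside ∷ I) = refl

parity-#Omitting₁-JJ [] = refl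
parity-#Omitting₁-JJ (inside ∷ I) = refl
parity-#Omitting₁-JJ (outside ∷ I) = begin
  parity (#Omitting 1 I-turn J-turn I + b)      ≡⟨ ℙ.+-homo-+ (#Omitting 1 I-turn J-turn I) b ⟩
  parity (#Omitting 1 I-turn J-turn I) ⊕ parity b ≡⟨ cong (_⊕ parity b) (parity-#Omitting₁-IJ I) ⟩
  parity (a + b) ⊕ parity b                     ≡⟨ cong (_⊕ parity b) (ℙ.+-homo-+ a b) ⟩
  parity a ⊕ parity b ⊕ parity b                ≡⟨ ℙ.+-assoc (parity a) (parity b) (parity b) ⟩
  parity a ⊕ (parity b ⊕ parity b)              ≡⟨ cong (parity a ⊕_) (ℙ.p+p≡0ℙ (parity b)) ⟩
  parity a ⊕ 0ℙ                                 ≡⟨ ℙ.+-identityʳ (parity a) ⟩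
  parity a                                      ∎
  where
  open ≡-Reasoning
  a = #Omitting 0 I-turn I-turn I
  b = #Omitting 0 J-turn J-turn I

parity-#Omitting₁-IJ [] = refl
parity-#Omitting₁-IJ (inside ∷ I) =
  trans (parity-#Omitting₁-JJ I) (cong parity (sym (+-identityʳ (#Omitting 0 J-turn I-turn I))))
parity-#Omitting₁-IJ (outside ∷ I) = refl

parity≡0ℙ⇒2∣ : ∀ m → parity m ≡ 0ℙ → 2 ∣ m
parity≡0ℙ⇒2∣ zero _ = divides 0 refl
parity≡0ℙ⇒2∣ (suc (suc m)) even with divides q eq ← parity≡0ℙ⇒2∣ m even =
  divides (suc q) (cong (2 +_) eq)

Good≐Omitting₁ : ∀ {p} {I : Subset n} → ∣ ∁ I ∣ ≡ suc (suc p) →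
  Good (suc p) I ≐ (Omitting 1 I-turn I-turn I ∪ Omitting 1 J-turn J-turn I)
Good≐Omitting₁ {p = p} {I} ∣∁I∣≡2+p = good⇒omitting , omitting⇒good
  where
  good⇒omitting : ∀ {J} → Good (suc p) I J →
    Omitting 1 I-turn I-turn I J ⊎ Omitting 1 J-turn J-turn I J
  good⇒omitting (_ , ∣J∣≡1+p , alt) = Sum.map (size ,_) (size ,_) (alternate⇒alternation alt)
    where size = trans (cong suc ∣J∣≡1+p) (sym ∣∁I∣≡2+p)

  omitting⇒good : ∀ {J} → Omitting 1 I-turn I-turn I J ⊎ Omitting 1 J-turn J-turn I J →
    Good (suc p) I J
  omitting⇒good (inj₁ (e , a)) =
    alternation⇒⊆∁ a , suc-injective (trans e ∣∁I∣≡2+p) , alternation⇒alternate (inj₁ a)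
  omitting⇒good (inj₂ (e , a)) =
    alternation⇒⊆∁ a , suc-injective (trans e ∣∁I∣≡2+p) , alternation⇒alternate (inj₂ a)

countAlternating-even : ∀ {p} (I : Subset n) → ∣ I ∣ ≡ suc p → ∣ ∁ I ∣ ≡ suc (suc p) →
  2 ∣ countAlternating (suc p) I
countAlternating-even {n = n} {p} I ∣I∣≡1+p ∣∁I∣≡2+p = parity≡0ℙ⇒2∣ _ (begin
  parity (countAlternating (suc p) I)
    ≡⟨ cong parity (count-≐ (good? (suc p) I) (II? ∪? JJ?) (Good≐Omitting₁ ∣∁I∣≡2+p) S) ⟩
  parity (count (II? ∪? JJ?) S)
    ≡⟨ cong parity (count-∪ II? JJ? starting-turn-unique S) ⟩
  parity (count II? S + count JJ? S)
    ≡⟨ cong parity (cong₂ _+_ (count-Omitting 1 I-turn I-turn I) (count-Omitting 1 J-turn J-turn I)) ⟩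
  parity (#Omitting 1 I-turn I-turn I + #Omitting 1 J-turn J-turn I)
    ≡⟨ ℙ.+-homo-+ (#Omitting 1 I-turn I-turn I) (#Omitting 1 J-turn J-turn I) ⟩
  parity (#Omitting 1 I-turn I-turn I) ⊕ parity (#Omitting 1 J-turn J-turn I)
    ≡⟨ cong₂ _⊕_ (parity-#Omitting₁-II I) (parity-#Omitting₁-JJ I) ⟩
  parity (#Omitting 0 J-turn I-turn I) ⊕ parity (#Omitting 0 J-turn I-turn I)
    ≡⟨ ℙ.p+p≡0ℙ (parity (#Omitting 0 J-turn I-turn I)) ⟩
  0ℙ ∎)
  where
  open ≡-Reasoning
  S = allSubsets n
  II? = omitting? 1 I-turn I-turn I
  JJ? = omitting? 1 J-turn J-turn I

  starting-turn-unique : ∀ {J} → Omitting 1 I-turn I-turn I J → Omitting 1 J-turn J-turn I J → ⊥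
  starting-turn-unique (_ , a) (_ , b) =
    0≢1+n (trans (sym (alternations-from-both-turns⇒∣I∣≡0 a b)) ∣I∣≡1+p)

lemma7 : (k : ℕ) → .{{_ : NonZero k}} → (I : Subset (2 * k + 3)) → ∣ I ∣ ≡ suc k
         → 2 ∣ countAlternating (suc k) I
lemma7 k I ∣I∣≡1+k = countAlternating-even I ∣I∣≡1+k (begin
  ∣ ∁ I ∣                      ≡⟨ ∣∁p∣≡n∸∣p∣ I ⟩
  2 * k + 3 ∸ ∣ I ∣            ≡⟨ cong (2 * k + 3 ∸_) ∣I∣≡1+k ⟩
  2 * k + 3 ∸ suc k            ≡⟨ cong (_∸ suc k) (split k) ⟩
  suc k + suc (suc k) ∸ suc k  ≡⟨ m+n∸m≡n (suc k) (suc (suc k)) ⟩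
  suc (suc k)                  ∎)
  where
  open ≡-Reasoning
  split : ∀ k → 2 * k + 3 ≡ suc k + suc (suc k)
  split = solve-∀
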